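{- Let $G = Z_{10}\times Z_{143}$ with multiplication $[x,y][u,v] = [x+u \bmod 10,\; y\cdot 64^{u} + v \bmod 143]$ (a group of order $1430$). Let $S=\{g,g^{ -1} : g\in\{[0,84],[7,54],[1,51],[7,121],[5,0]\}\}$. Then $S$ consists of exactly $9$ non-identity elements and the Cayley graph $\mathrm{Cay}(G,S)$ is a connected $9$-regular graph of diameter $4$ on $1430$ vertices.
   Context: For a finite group $G$ and an inverse-closed subset $S\subseteq G$ not containing the identity, the Cayley graph $\mathrm{Cay}(G,S)$ is the undirected graph with vertex set $G$ in which $x$ and $y$ are adjacent iff $y=xs$ for some $s\in S$; it is $|S|$-regular. The diameter of a connected graph is the maximum over all pairs of vertices of the length of a shortest path between them. For integers $m,n$ and a unit $a$ of $Z_n$ whose multiplicative order divides $m$, the group $m\times_a n$ is the set $Z_m\times Z_n$ with multiplication $[x,y][u,v]=[x+u \bmod m,\; y a^u+v \bmod n]$. -}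

module Defs where

open import Data.Nat using (ℕ; zero; suc; _+_; _*_; _^_; _≤_; _<_)
open import Data.Nat.DivMod using (_mod_)
open import Data.Fin using (Fin; toℕ)
open import Data.Product using (_×_; _,_; Σ; ∃; ∃-syntax)
open import Data.Sum using (_⊎_)
open import Data.Unit using (⊤)
open import Data.List using (List; []; _∷_; length)
open import Data.List.Membership.Propositional using (_∈_)
open import Data.List.Relation.Unary.Any using (Any)
open import Data.List.Relation.Unary.Unique.Propositional using (Unique)
open import Relation.Binary.PropositionalEquality using (_≡_)
open import Relation.Nullary using (¬_)
open import Function.Bundles using (_⇔_)

G : Set
G = Fin 10 × Fin 143

_·_ : G → G → G
(x , y) · (u , v) = ((toℕ x + toℕ u) mod 10) , ((toℕ y * 64 ^ toℕ u + toℕ v) mod 143)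

e : G
e = (0 mod 10) , (0 mod 143)

[_,_] : ℕ → ℕ → G
[ x , y ] = (x mod 10) , (y mod 143)

gens : List G
gens = [ 0 , 84 ] ∷ [ 7 , 54 ] ∷ [ 1 , 51 ] ∷ [ 7 , 121 ] ∷ [ 5 , 0 ] ∷ []

InS : G → Set
InS s = Any (λ g → (s ≡ g) ⊎ (s · g ≡ e)) gens

HasCard : (G → Set) → ℕ → Set
HasCard P k = Σ (List G) λ L → Unique L × length L ≡ k × (∀ z → (z ∈ L) ⇔ P z)

Adj : G → G → Set
Adj x y = ∃[ s ] (InS s × y ≡ x · s)

data Walk : G → G → ℕ → Set where
  here  : ∀ {x} → Walk x x zero
  step  : ∀ {x y z n} → Adj x y → Walk y z n → Walk x z (suc n)

DistLe : G → G → ℕ → Set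
DistLe x y d = ∃[ n ] (n ≤ d × Walk x y n)

Connected : Set
Connected = ∀ x y → ∃[ n ] Walk x y n

Regular : ℕ → Set
Regular k = ∀ x → HasCard (Adj x) k

-- diameter = d: every pair at distance ≤ d, and some pair at distance exactly d
-- (i.e. not at distance ≤ d-1, expressed as: no walk of length < d)
Diameter : ℕ → Set
Diameter d = (∀ x y → DistLe x y d) × ∃[ x ] ∃[ y ] (∀ n → n < d → ¬ Walk x y n)

NumVertices : ℕ → Set
NumVertices k = HasCard (λ _ → ⊤) k

-- 64 ^ 10 ≡ 1 (mod 143), so in the product rule the exponent of 64 only matters modulo 10, and
-- 10 ×₆₄ 143 is a group.  Left multiplication is then an automorphism of Cay(G,S), so every
-- distance is a distance from e.  Distances from e are certified by a breadth-first search tree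
-- in which every vertex reaches e in at most 4 steps, and [0,1] is seen to lie at distance 4 by
-- enumerating the 1 + 9 + 81 + 729 walks of length less than 4 from e.
module Submission where

open import Defs
open import Data.Product using (_×_; _,_; ∃-syntax)
open import Relation.Binary.PropositionalEquality as ≡
  using (_≡_; refl; sym; trans; cong; cong₂; subst₂; module ≡-Reasoning)
open import Relation.Nullary using (¬_; Dec; yes; no; does; ¬?)

open import Algebra.Bundles using (Group; Monoid)
open import Algebra.Definitions using (LeftInverse; RightInverse)
open import Algebra.Structures using (IsMonoid; IsGroup)
open import Data.Bool using (Bool; _∨_; T)
open import Data.Bool.ListAction using (all)
open import Data.Fin using (Fin; toℕ)
open import Data.Fin.Properties using (toℕ-injective; toℕ-fromℕ<; toℕ<n)
import Data.Fin.Properties as Fin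
open import Data.List using (List; []; _∷_; map; concatMap; deduplicate; cartesianProduct; allFin)
import Data.List as List
open import Data.List.Membership.Propositional using (_∈_; lose; find)
open import Data.List.Membership.Propositional.Properties
  using (∈-map⁺; ∈-map⁻; ∈-concatMap⁺; ∈-concatMap⁻; ∈-deduplicate⁺; ∈-deduplicate⁻; ∈-cartesianProduct⁺; ∈-allFin; ∈-lookup)
open import Data.List.Properties using (length-map)
open import Data.List.Relation.Unary.All using (all?)
import Data.List.Relation.Unary.All as All
import Data.List.Relation.Unary.All.Properties as All
open import Data.List.Relation.Unary.Any using (Any; here; there; any?)
import Data.List.Relation.Unary.Any as Any
open import Data.List.Relation.Unary.Unique.Propositional using (Unique)
import Data.List.Relation.Unary.Unique.Propositional.Properties as Unique
open import Data.List.Relation.Unary.Unique.DecPropositional.Properties using (deduplicate-!)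
open import Data.Nat using (ℕ; zero; suc; _+_; _*_; _∸_; _^_; _<_; s≤s; z≤n; NonZero)
open import Data.Nat.DivMod
  using (_%_; _/_; _mod_; m%n%n≡m%n; %-distribˡ-+; %-distribˡ-*; m%n<n; m%n≤n; m≡m%n+[m/n]*n; n%n≡0; m*n%n≡0; m<n⇒m%n≡m)
open import Data.Nat.Properties using (+-identityʳ; +-assoc; *-identityʳ; *-comm; ^-*-assoc; ^-distribˡ-+-*; m+[n∸m]≡n)
open import Data.Nat.Solver using (module +-*-Solver)
open import Data.Product.Properties using (≡-dec)
open import Data.Sum using (_⊎_; inj₁; inj₂)
open import Data.Unit using (tt)
open import Data.Vec using (Vec; []; _∷_)
import Data.Vec as Vec
open import Function using (_∘_)
open import Function.Bundles using (_⇔_; mk⇔; Equivalence)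
open import Level using (0ℓ)
open import Relation.Binary.Bundles using (Setoid)
import Relation.Binary.Construct.On as On
open import Relation.Binary.Definitions using (DecidableEquality)
open import Relation.Binary.PropositionalEquality.Algebra using (isMagma)
open import Relation.Nullary.Decidable using (toWitness; from-no; map′)

module ModularArithmetic (n : ℕ) .{{_ : NonZero n}} where

  infix 4 _≈_
  _≈_ : ℕ → ℕ → Set
  x ≈ y = x % n ≡ y % n

  ≈-setoid : Setoid 0ℓ 0ℓ
  ≈-setoid = On.setoid (≡.setoid ℕ) (_% n)

  open Setoid ≈-setoid public using () renaming (refl to ≈-refl; trans to ≈-trans)

  ≡⇒≈ : ∀ {x y} → x ≡ y → x ≈ y
  ≡⇒≈ = cong (_% n)

  %-≈ : ∀ x → x % n ≈ x
  %-≈ x = m%n%n≡m%n x n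

  +-cong : ∀ {x x′ y y′} → x ≈ x′ → y ≈ y′ → x + y ≈ x′ + y′
  +-cong {x} {x′} {y} {y′} x≈x′ y≈y′ = begin
    (x + y) % n                 ≡⟨ %-distribˡ-+ x y n ⟩
    (x % n + y % n) % n         ≡⟨ cong₂ (λ u v → (u + v) % n) x≈x′ y≈y′ ⟩
    (x′ % n + y′ % n) % n       ≡⟨ %-distribˡ-+ x′ y′ n ⟨
    (x′ + y′) % n               ∎
    where open ≡-Reasoning

  *-cong : ∀ {x x′ y y′} → x ≈ x′ → y ≈ y′ → x * y ≈ x′ * y′
  *-cong {x} {x′} {y} {y′} x≈x′ y≈y′ = begin
    (x * y) % n                 ≡⟨ %-distribˡ-* x y n ⟩
    (x % n * (y % n)) % n       ≡⟨ cong₂ (λ u v → (u * v) % n) x≈x′ y≈y′ ⟩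
    (x′ % n * (y′ % n)) % n     ≡⟨ %-distribˡ-* x′ y′ n ⟨
    (x′ * y′) % n               ∎
    where open ≡-Reasoning

  ≈1⇒^≈1 : ∀ {x} → x ≈ 1 → ∀ k → x ^ k ≈ 1
  ≈1⇒^≈1 x≈1 zero    = ≈-refl
  ≈1⇒^≈1 x≈1 (suc k) = *-cong x≈1 (≈1⇒^≈1 x≈1 k)

  ^-periodic : ∀ {a} m .{{_ : NonZero m}} → a ^ m ≈ 1 → ∀ k → a ^ (k % m) ≈ a ^ k
  ^-periodic {a} m aᵐ≈1 k = begin
    a ^ (k % m)                          ≈⟨ ≡⇒≈ (*-identityʳ (a ^ (k % m))) ⟨
    a ^ (k % m) * 1                      ≈⟨ *-cong {a ^ (k % m)} ≈-refl (≈1⇒^≈1 aᵐ≈1 (k / m)) ⟨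
    a ^ (k % m) * (a ^ m) ^ (k / m)      ≈⟨ ≡⇒≈ (cong (a ^ (k % m) *_) (^-*-assoc a m (k / m))) ⟩
    a ^ (k % m) * a ^ (m * (k / m))      ≈⟨ ≡⇒≈ (^-distribˡ-+-* a (k % m) (m * (k / m))) ⟨
    a ^ (k % m + m * (k / m))            ≈⟨ ≡⇒≈ (cong (λ j → a ^ (k % m + j)) (*-comm m (k / m))) ⟩
    a ^ (k % m + k / m * m)              ≈⟨ ≡⇒≈ (cong (a ^_) (m≡m%n+[m/n]*n k m)) ⟨
    a ^ k                                ∎
    where open import Relation.Binary.Reasoning.Setoid ≈-setoid

  -_ : ℕ → ℕ
  - x = n ∸ x % n

  +-inverseʳ : ∀ x → x + - x ≈ 0
  +-inverseʳ x = begin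
    x + (n ∸ x % n)         ≈⟨ +-cong (%-≈ x) ≈-refl ⟨
    x % n + (n ∸ x % n)     ≈⟨ ≡⇒≈ (m+[n∸m]≡n (m%n≤n x n)) ⟩
    n                       ≈⟨ trans (n%n≡0 n) (sym (m*n%n≡0 0 n)) ⟩
    0                       ∎
    where open import Relation.Binary.Reasoning.Setoid ≈-setoid

  toℕ-mod : ∀ x → toℕ (x mod n) ≡ x % n
  toℕ-mod x = toℕ-fromℕ< (m%n<n x n)

  toℕ-mod-≈ : ∀ x → toℕ (x mod n) ≈ x
  toℕ-mod-≈ x = trans (≡⇒≈ (toℕ-mod x)) (%-≈ x)

  toℕ-0-mod : toℕ (0 mod n) ≡ 0
  toℕ-0-mod = trans (toℕ-mod 0) (m*n%n≡0 0 n)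

  mod-cong : ∀ {x y} → x ≈ y → x mod n ≡ y mod n
  mod-cong {x} {y} x≈y = toℕ-injective (trans (toℕ-fromℕ< (m%n<n x n)) (trans x≈y (sym (toℕ-fromℕ< (m%n<n y n)))))

  ≈-toℕ⇒mod≡ : ∀ {x} {i : Fin n} → x ≈ toℕ i → x mod n ≡ i
  ≈-toℕ⇒mod≡ {x} {i} x≈i = toℕ-injective (trans (toℕ-fromℕ< (m%n<n x n)) (trans x≈i (m<n⇒m%n≡m (toℕ<n i))))

module _ {c ℓ} (M : Monoid c ℓ) where

  open Monoid M
  open import Relation.Binary.Reasoning.Setoid setoid

  rightInverse⇒leftInverse : (_⁻¹ : Carrier → Carrier) → RightInverse _≈_ ε _⁻¹ _∙_ → LeftInverse _≈_ ε _⁻¹ _∙_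
  rightInverse⇒leftInverse _⁻¹ inverseʳ x = begin
    x ⁻¹ ∙ x                          ≈⟨ identityʳ (x ⁻¹ ∙ x) ⟨
    x ⁻¹ ∙ x ∙ ε                      ≈⟨ ∙-congˡ (inverseʳ (x ⁻¹)) ⟨
    x ⁻¹ ∙ x ∙ (x ⁻¹ ∙ x ⁻¹ ⁻¹)       ≈⟨ assoc (x ⁻¹) x (x ⁻¹ ∙ x ⁻¹ ⁻¹) ⟩
    x ⁻¹ ∙ (x ∙ (x ⁻¹ ∙ x ⁻¹ ⁻¹))     ≈⟨ ∙-congˡ (assoc x (x ⁻¹) (x ⁻¹ ⁻¹)) ⟨
    x ⁻¹ ∙ (x ∙ x ⁻¹ ∙ x ⁻¹ ⁻¹)       ≈⟨ ∙-congˡ (∙-congʳ (inverseʳ x)) ⟩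
    x ⁻¹ ∙ (ε ∙ x ⁻¹ ⁻¹)              ≈⟨ ∙-congˡ (identityˡ (x ⁻¹ ⁻¹)) ⟩
    x ⁻¹ ∙ x ⁻¹ ⁻¹                    ≈⟨ inverseʳ (x ⁻¹) ⟩
    ε                                 ∎

module SemidirectProduct (m n a : ℕ) .{{_ : NonZero m}} .{{_ : NonZero n}} where

  private
    module ℤₘ = ModularArithmetic m
    module ℤₙ = ModularArithmetic n

  Carrier : Set
  Carrier = Fin m × Fin n

  _∙_ : Carrier → Carrier → Carrier
  (x , y) ∙ (u , v) = ((toℕ x + toℕ u) mod m) , ((toℕ y * a ^ toℕ u + toℕ v) mod n)

  ε : Carrier
  ε = (0 mod m) , (0 mod n)

  _⁻¹ : Carrier → Carrier
  (x , y) ⁻¹ = x′ , (ℤₙ.- (toℕ y * a ^ toℕ x′)) mod n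
    where x′ = (ℤₘ.- toℕ x) mod m

  identityˡ : ∀ g → ε ∙ g ≡ g
  identityˡ (u , v) = cong₂ _,_
    (ℤₘ.≈-toℕ⇒mod≡ (ℤₘ.+-cong (ℤₘ.toℕ-mod-≈ 0) ℤₘ.≈-refl))
    (ℤₙ.≈-toℕ⇒mod≡ (ℤₙ.+-cong (ℤₙ.*-cong (ℤₙ.toℕ-mod-≈ 0) ℤₙ.≈-refl) ℤₙ.≈-refl))

  identityʳ : ∀ g → g ∙ ε ≡ g
  identityʳ (u , v) = cong₂ _,_
    (ℤₘ.≈-toℕ⇒mod≡ (ℤₘ.≡⇒≈ (trans (cong (toℕ u +_) ℤₘ.toℕ-0-mod) (+-identityʳ (toℕ u)))))
    (ℤₙ.≈-toℕ⇒mod≡ (ℤₙ.≡⇒≈ (begin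
      toℕ v * a ^ toℕ (0 mod m) + toℕ (0 mod n)   ≡⟨ cong₂ (λ i j → toℕ v * a ^ i + j) ℤₘ.toℕ-0-mod ℤₙ.toℕ-0-mod ⟩
      toℕ v * 1 + 0                               ≡⟨ +-identityʳ (toℕ v * 1) ⟩
      toℕ v * 1                                   ≡⟨ *-identityʳ (toℕ v) ⟩
      toℕ v                                       ∎)))
    where open ≡-Reasoning

  inverseʳ : ∀ g → g ∙ (g ⁻¹) ≡ ε
  inverseʳ (u , v) = cong₂ _,_
    (ℤₘ.mod-cong (ℤₘ.≈-trans (ℤₘ.+-cong ℤₘ.≈-refl (ℤₘ.toℕ-mod-≈ _)) (ℤₘ.+-inverseʳ (toℕ u))))
    (ℤₙ.mod-cong (ℤₙ.≈-trans (ℤₙ.+-cong ℤₙ.≈-refl (ℤₙ.toℕ-mod-≈ _)) (ℤₙ.+-inverseʳ _)))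

  module _ (aᵐ≈1 : a ^ m ℤₙ.≈ 1) where

    assoc : ∀ f g h → (f ∙ g) ∙ h ≡ f ∙ (g ∙ h)
    assoc (x , y) (u , v) (p , q) = cong₂ _,_ (ℤₘ.mod-cong first) (ℤₙ.mod-cong second)
      where
      X = toℕ x ; Y = toℕ y ; U = toℕ u ; V = toℕ v ; P = toℕ p ; Q = toℕ q

      first : toℕ ((X + U) mod m) + P ℤₘ.≈ X + toℕ ((U + P) mod m)
      first = begin
        toℕ ((X + U) mod m) + P     ≈⟨ ℤₘ.+-cong (ℤₘ.toℕ-mod-≈ (X + U)) ℤₘ.≈-refl ⟩
        X + U + P                   ≈⟨ ℤₘ.≡⇒≈ (+-assoc X U P) ⟩
        X + (U + P)                 ≈⟨ ℤₘ.+-cong ℤₘ.≈-refl (ℤₘ.toℕ-mod-≈ (U + P)) ⟨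
        X + toℕ ((U + P) mod m)     ∎
        where open import Relation.Binary.Reasoning.Setoid ℤₘ.≈-setoid

      second : toℕ ((Y * a ^ U + V) mod n) * a ^ P + Q
               ℤₙ.≈ Y * a ^ toℕ ((U + P) mod m) + toℕ ((V * a ^ P + Q) mod n)
      second = begin
        toℕ ((Y * a ^ U + V) mod n) * a ^ P + Q        ≈⟨ ℤₙ.+-cong (ℤₙ.*-cong (ℤₙ.toℕ-mod-≈ _) ℤₙ.≈-refl) ℤₙ.≈-refl ⟩
        (Y * a ^ U + V) * a ^ P + Q                    ≈⟨ ℤₙ.≡⇒≈ (distrib Y (a ^ U) V (a ^ P) Q) ⟩
        Y * (a ^ U * a ^ P) + (V * a ^ P + Q)          ≈⟨ ℤₙ.≡⇒≈ (cong (λ t → Y * t + (V * a ^ P + Q)) (^-distribˡ-+-* a U P)) ⟨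
        Y * a ^ (U + P) + (V * a ^ P + Q)              ≈⟨ ℤₙ.+-cong (ℤₙ.*-cong {Y} ℤₙ.≈-refl (ℤₙ.^-periodic m aᵐ≈1 (U + P))) (ℤₙ.toℕ-mod-≈ _) ⟨
        Y * a ^ ((U + P) % m) + toℕ ((V * a ^ P + Q) mod n)  ≈⟨ ℤₙ.≡⇒≈ (cong (λ i → Y * a ^ i + toℕ ((V * a ^ P + Q) mod n)) (ℤₘ.toℕ-mod (U + P))) ⟨
        Y * a ^ toℕ ((U + P) mod m) + toℕ ((V * a ^ P + Q) mod n)  ∎
        where
        open import Relation.Binary.Reasoning.Setoid ℤₙ.≈-setoid
        open +-*-Solver
        distrib : ∀ y α v β q → (y * α + v) * β + q ≡ y * (α * β) + (v * β + q)
        distrib = solve 5 (λ y α v β q → (y :* α :+ v) :* β :+ q := y :* (α :* β) :+ (v :* β :+ q)) refl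

    isMonoid : IsMonoid _≡_ _∙_ ε
    isMonoid = record
      { isSemigroup = record { isMagma = isMagma _∙_ ; assoc = assoc }
      ; identity    = identityˡ , identityʳ
      }

    isGroup : IsGroup _≡_ _∙_ ε _⁻¹
    isGroup = record
      { isMonoid = isMonoid
      ; inverse  = rightInverse⇒leftInverse (record { isMonoid = isMonoid }) _⁻¹ inverseʳ , inverseʳ
      ; ⁻¹-cong  = cong _⁻¹
      }

open SemidirectProduct 10 143 64 using (_⁻¹)

·-isGroup : IsGroup _≡_ _·_ e _⁻¹
·-isGroup = SemidirectProduct.isGroup 10 143 64 refl

·-group : Group 0ℓ 0ℓ
·-group = record { isGroup = ·-isGroup }

open IsGroup ·-isGroup using (assoc; identityʳ; inverseˡ)
open import Algebra.Properties.Group ·-group using (∙-cancelˡ; inverseˡ-unique; inverseʳ-unique; \\-leftDividesˡ; //-rightDividesʳ)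

_≟_ : DecidableEquality G
_≟_ = ≡-dec Fin._≟_ Fin._≟_

vertices : List G
vertices = cartesianProduct (allFin 10) (allFin 143)

∈-vertices : ∀ g → g ∈ vertices
∈-vertices (x , y) = ∈-cartesianProduct⁺ (∈-allFin x) (∈-allFin y)

all-vertices-sound : (p : G → Bool) → T (all p vertices) → ∀ g → T (p g)
all-vertices-sound p ok g = All.lookup (All.all⁺ p vertices ok) (∈-vertices g)

numVertices : NumVertices 1430
numVertices = vertices , Unique.cartesianProduct⁺ (Unique.allFin⁺ 10) (Unique.allFin⁺ 143) , refl ,
  λ g → mk⇔ _ (λ _ → ∈-vertices g)

connectionSet : List G
connectionSet = [ 0 , 84 ] ∷ [ 0 , 59 ] ∷ [ 7 , 54 ] ∷ [ 3 , 80 ] ∷ [ 1 , 51 ] ∷ [ 9 , 64 ] ∷ [ 7 , 121 ] ∷ [ 3 , 121 ] ∷ [ 5 , 0 ] ∷ []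

symmetrise : List G → List G
symmetrise gs = deduplicate _≟_ (concatMap (λ g → g ∷ g ⁻¹ ∷ []) gs)

connectionSet≡symmetrise : connectionSet ≡ symmetrise gens
connectionSet≡symmetrise = refl

∈[g,g⁻¹]⇔ : ∀ {s g} → s ∈ g ∷ g ⁻¹ ∷ [] ⇔ (s ≡ g ⊎ s · g ≡ e)
∈[g,g⁻¹]⇔ {s} {g} = mk⇔ to from
  where
  to : s ∈ g ∷ g ⁻¹ ∷ [] → s ≡ g ⊎ s · g ≡ e
  to (here refl)         = inj₁ refl
  to (there (here refl)) = inj₂ (inverseˡ g)
  from : s ≡ g ⊎ s · g ≡ e → s ∈ g ∷ g ⁻¹ ∷ []
  from (inj₁ refl)  = here refl
  from (inj₂ sg≡e) = there (here (inverseˡ-unique s g sg≡e))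

∈⇔InS : ∀ {s} → s ∈ connectionSet ⇔ InS s
∈⇔InS {s} = mk⇔
  (Any.map (Equivalence.to ∈[g,g⁻¹]⇔) ∘ ∈-concatMap⁻ _ ∘ ∈-deduplicate⁻ _≟_ _ ∘ ≡.subst (s ∈_) connectionSet≡symmetrise)
  (≡.subst (s ∈_) (sym connectionSet≡symmetrise) ∘ ∈-deduplicate⁺ _≟_ ∘ ∈-concatMap⁺ _ ∘ Any.map (Equivalence.from ∈[g,g⁻¹]⇔))

InS-⁻¹ : ∀ {s} → InS s → InS (s ⁻¹)
InS-⁻¹ {s} = Any.map λ where
  (inj₁ refl)  → inj₂ (inverseˡ s)
  (inj₂ sg≡e) → inj₁ (sym (inverseʳ-unique s _ sg≡e))

InS⇒≢e : ∀ s → InS s → ¬ s ≡ e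
InS⇒≢e s = All.lookup (toWitness {a? = all? (λ s → ¬? (s ≟ e)) connectionSet} tt) ∘ Equivalence.from ∈⇔InS

adj⇔∈ : ∀ {x z} → z ∈ map (x ·_) connectionSet ⇔ Adj x z
adj⇔∈ {x} = mk⇔ to from
  where
  to : ∀ {z} → z ∈ map (x ·_) connectionSet → Adj x z
  to z∈ with ∈-map⁻ (x ·_) {xs = connectionSet} z∈
  ... | s , s∈ , refl = s , Equivalence.to ∈⇔InS s∈ , refl
  from : ∀ {z} → Adj x z → z ∈ map (x ·_) connectionSet
  from (s , s∈S , refl) = ∈-map⁺ (x ·_) (Equivalence.from ∈⇔InS s∈S)

connectionSet-unique : Unique connectionSet
connectionSet-unique =
  ≡.subst Unique (sym connectionSet≡symmetrise) (deduplicate-! _≟_ (concatMap (λ g → g ∷ g ⁻¹ ∷ []) gens))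

cardS : HasCard InS 9
cardS = connectionSet , connectionSet-unique , refl , λ _ → ∈⇔InS

regular : Regular 9
regular x =
  map (x ·_) connectionSet , Unique.map⁺ (λ {s} {t} → ∙-cancelˡ x s t) connectionSet-unique ,
  length-map (x ·_) connectionSet , λ z → adj⇔∈ {x} {z}

_∷ʳ_ : ∀ {x y z n} → Walk x y n → Adj y z → Walk x z (suc n)
here       ∷ʳ y~z = step y~z here
step x~w w ∷ʳ y~z = step x~w (w ∷ʳ y~z)

translate : ∀ g {x y n} → Walk x y n → Walk (g · x) (g · y) n
translate g here = here
translate g {x} (step (s , s∈S , refl) w) = step (s , s∈S , sym (assoc g x s)) (translate g w)

DistLe-translate : ∀ g {x y k} → DistLe x y k → DistLe (g · x) (g · y) k
DistLe-translate g (n , n≤k , w) = n , n≤k , translate g w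

DistLe⇒Walk : ∀ {x y k} → DistLe x y k → ∃[ n ] Walk x y n
DistLe⇒Walk (n , _ , w) = n , w

adj-back : ∀ g {t} → InS t → Adj (g · t) g
adj-back g {t} t∈S = t ⁻¹ , InS-⁻¹ t∈S , sym (//-rightDividesʳ t g)

-- Entry (x , y) is the position in connectionSet of an s such that [x,y] · s is the parent of
-- [x,y] in a breadth-first search tree of Cay(G,S) rooted at e; the entry at e is never read.
-- All entries are below 9, so the mod 9 in bfsIndex only adjusts the type.
bfsTree : Vec (Vec ℕ 143) 10
bfsTree =
  ( 0 ∷ 0 ∷ 0 ∷ 3 ∷ 2 ∷ 3 ∷ 2 ∷ 8 ∷ 1 ∷ 3 ∷ 2 ∷ 4 ∷ 1 ∷ 0 ∷ 0 ∷ 2 ∷ 0 ∷ 1 ∷ 0 ∷ 6 ∷ 5 ∷ 2 ∷ 8 ∷ 3 ∷ 2 ∷ 1 ∷ 1 ∷ 1 ∷ 3 ∷ 2 ∷ 7 ∷ 2 ∷ 3 ∷ 6 ∷ 0 ∷ 2 ∷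
      4 ∷ 3 ∷ 1 ∷ 1 ∷ 8 ∷ 6 ∷ 0 ∷ 1 ∷ 8 ∷ 2 ∷ 4 ∷ 4 ∷ 5 ∷ 2 ∷ 1 ∷ 0 ∷ 0 ∷ 2 ∷ 0 ∷ 0 ∷ 6 ∷ 2 ∷ 5 ∷ 0 ∷ 4 ∷ 2 ∷ 2 ∷ 0 ∷ 0 ∷ 6 ∷ 0 ∷ 7 ∷ 2 ∷ 8 ∷ 6 ∷ 3 ∷
      3 ∷ 3 ∷ 4 ∷ 3 ∷ 3 ∷ 0 ∷ 2 ∷ 1 ∷ 1 ∷ 2 ∷ 6 ∷ 5 ∷ 1 ∷ 5 ∷ 6 ∷ 4 ∷ 1 ∷ 1 ∷ 2 ∷ 1 ∷ 1 ∷ 0 ∷ 3 ∷ 5 ∷ 3 ∷ 4 ∷ 2 ∷ 6 ∷ 0 ∷ 1 ∷ 2 ∷ 6 ∷ 0 ∷ 0 ∷ 3 ∷ 2 ∷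
      4 ∷ 1 ∷ 2 ∷ 3 ∷ 8 ∷ 3 ∷ 3 ∷ 4 ∷ 0 ∷ 0 ∷ 0 ∷ 2 ∷ 7 ∷ 2 ∷ 4 ∷ 4 ∷ 7 ∷ 1 ∷ 0 ∷ 1 ∷ 4 ∷ 1 ∷ 0 ∷ 0 ∷ 8 ∷ 3 ∷ 4 ∷ 0 ∷ 8 ∷ 3 ∷ 7 ∷ 6 ∷ 2 ∷ 1 ∷ 1 ∷ [])
  ∷ ( 6 ∷ 5 ∷ 0 ∷ 7 ∷ 2 ∷ 4 ∷ 2 ∷ 3 ∷ 0 ∷ 1 ∷ 2 ∷ 2 ∷ 0 ∷ 0 ∷ 4 ∷ 0 ∷ 5 ∷ 3 ∷ 0 ∷ 1 ∷ 0 ∷ 1 ∷ 1 ∷ 8 ∷ 5 ∷ 0 ∷ 0 ∷ 0 ∷ 7 ∷ 4 ∷ 6 ∷ 8 ∷ 3 ∷ 1 ∷ 0 ∷ 0 ∷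
      6 ∷ 0 ∷ 1 ∷ 6 ∷ 8 ∷ 4 ∷ 4 ∷ 4 ∷ 2 ∷ 1 ∷ 2 ∷ 8 ∷ 0 ∷ 5 ∷ 1 ∷ 5 ∷ 0 ∷ 5 ∷ 3 ∷ 1 ∷ 2 ∷ 0 ∷ 2 ∷ 7 ∷ 0 ∷ 7 ∷ 0 ∷ 3 ∷ 3 ∷ 3 ∷ 2 ∷ 3 ∷ 3 ∷ 0 ∷ 5 ∷ 5 ∷
      4 ∷ 1 ∷ 2 ∷ 1 ∷ 1 ∷ 1 ∷ 2 ∷ 3 ∷ 8 ∷ 8 ∷ 1 ∷ 0 ∷ 7 ∷ 0 ∷ 4 ∷ 6 ∷ 2 ∷ 0 ∷ 0 ∷ 2 ∷ 4 ∷ 7 ∷ 1 ∷ 2 ∷ 2 ∷ 6 ∷ 6 ∷ 6 ∷ 0 ∷ 5 ∷ 2 ∷ 2 ∷ 3 ∷ 0 ∷ 0 ∷ 5 ∷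
      0 ∷ 5 ∷ 0 ∷ 4 ∷ 0 ∷ 0 ∷ 4 ∷ 0 ∷ 2 ∷ 0 ∷ 7 ∷ 6 ∷ 0 ∷ 7 ∷ 3 ∷ 2 ∷ 1 ∷ 1 ∷ 4 ∷ 3 ∷ 4 ∷ 6 ∷ 1 ∷ 1 ∷ 2 ∷ 1 ∷ 7 ∷ 1 ∷ 5 ∷ 3 ∷ 0 ∷ 0 ∷ 0 ∷ 8 ∷ 1 ∷ [])
  ∷ ( 0 ∷ 0 ∷ 0 ∷ 1 ∷ 4 ∷ 6 ∷ 8 ∷ 4 ∷ 0 ∷ 2 ∷ 1 ∷ 6 ∷ 4 ∷ 2 ∷ 5 ∷ 8 ∷ 8 ∷ 0 ∷ 2 ∷ 0 ∷ 5 ∷ 1 ∷ 8 ∷ 0 ∷ 1 ∷ 1 ∷ 5 ∷ 1 ∷ 8 ∷ 8 ∷ 1 ∷ 0 ∷ 5 ∷ 1 ∷ 3 ∷ 2 ∷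
      1 ∷ 0 ∷ 5 ∷ 3 ∷ 4 ∷ 0 ∷ 1 ∷ 0 ∷ 1 ∷ 2 ∷ 2 ∷ 1 ∷ 1 ∷ 7 ∷ 6 ∷ 0 ∷ 1 ∷ 2 ∷ 3 ∷ 4 ∷ 1 ∷ 7 ∷ 0 ∷ 6 ∷ 3 ∷ 0 ∷ 1 ∷ 0 ∷ 0 ∷ 2 ∷ 1 ∷ 1 ∷ 0 ∷ 8 ∷ 8 ∷ 2 ∷
      4 ∷ 1 ∷ 0 ∷ 0 ∷ 8 ∷ 2 ∷ 2 ∷ 0 ∷ 4 ∷ 0 ∷ 8 ∷ 8 ∷ 5 ∷ 0 ∷ 4 ∷ 0 ∷ 0 ∷ 1 ∷ 2 ∷ 0 ∷ 4 ∷ 1 ∷ 5 ∷ 4 ∷ 0 ∷ 3 ∷ 3 ∷ 0 ∷ 1 ∷ 4 ∷ 2 ∷ 6 ∷ 1 ∷ 2 ∷ 1 ∷ 2 ∷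
      0 ∷ 0 ∷ 1 ∷ 5 ∷ 1 ∷ 0 ∷ 0 ∷ 7 ∷ 1 ∷ 2 ∷ 2 ∷ 0 ∷ 3 ∷ 7 ∷ 2 ∷ 0 ∷ 1 ∷ 3 ∷ 3 ∷ 7 ∷ 0 ∷ 0 ∷ 3 ∷ 2 ∷ 4 ∷ 1 ∷ 1 ∷ 0 ∷ 5 ∷ 4 ∷ 1 ∷ 0 ∷ 0 ∷ 0 ∷ 6 ∷ [])
  ∷ ( 1 ∷ 0 ∷ 6 ∷ 1 ∷ 7 ∷ 1 ∷ 1 ∷ 1 ∷ 0 ∷ 1 ∷ 0 ∷ 1 ∷ 7 ∷ 3 ∷ 1 ∷ 1 ∷ 3 ∷ 1 ∷ 8 ∷ 6 ∷ 0 ∷ 1 ∷ 8 ∷ 6 ∷ 1 ∷ 3 ∷ 1 ∷ 2 ∷ 4 ∷ 5 ∷ 4 ∷ 6 ∷ 0 ∷ 1 ∷ 0 ∷ 2 ∷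
      5 ∷ 0 ∷ 1 ∷ 2 ∷ 5 ∷ 0 ∷ 8 ∷ 1 ∷ 5 ∷ 7 ∷ 3 ∷ 4 ∷ 1 ∷ 8 ∷ 3 ∷ 3 ∷ 6 ∷ 5 ∷ 3 ∷ 0 ∷ 2 ∷ 1 ∷ 0 ∷ 4 ∷ 1 ∷ 0 ∷ 1 ∷ 0 ∷ 4 ∷ 4 ∷ 1 ∷ 8 ∷ 6 ∷ 4 ∷ 3 ∷ 0 ∷
      0 ∷ 5 ∷ 4 ∷ 5 ∷ 6 ∷ 0 ∷ 0 ∷ 1 ∷ 2 ∷ 0 ∷ 0 ∷ 7 ∷ 2 ∷ 5 ∷ 0 ∷ 1 ∷ 3 ∷ 3 ∷ 0 ∷ 3 ∷ 4 ∷ 5 ∷ 0 ∷ 8 ∷ 0 ∷ 6 ∷ 0 ∷ 2 ∷ 0 ∷ 0 ∷ 8 ∷ 1 ∷ 2 ∷ 1 ∷ 1 ∷ 1 ∷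
      0 ∷ 4 ∷ 0 ∷ 1 ∷ 0 ∷ 7 ∷ 0 ∷ 0 ∷ 4 ∷ 3 ∷ 7 ∷ 1 ∷ 4 ∷ 6 ∷ 3 ∷ 0 ∷ 0 ∷ 2 ∷ 1 ∷ 0 ∷ 7 ∷ 0 ∷ 1 ∷ 5 ∷ 0 ∷ 2 ∷ 0 ∷ 0 ∷ 5 ∷ 7 ∷ 8 ∷ 0 ∷ 1 ∷ 0 ∷ 5 ∷ [])
  ∷ ( 7 ∷ 1 ∷ 0 ∷ 5 ∷ 3 ∷ 1 ∷ 3 ∷ 6 ∷ 5 ∷ 1 ∷ 8 ∷ 6 ∷ 0 ∷ 1 ∷ 1 ∷ 5 ∷ 3 ∷ 1 ∷ 4 ∷ 3 ∷ 7 ∷ 5 ∷ 0 ∷ 5 ∷ 0 ∷ 0 ∷ 0 ∷ 0 ∷ 0 ∷ 0 ∷ 1 ∷ 2 ∷ 2 ∷ 8 ∷ 7 ∷ 7 ∷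
      3 ∷ 1 ∷ 3 ∷ 3 ∷ 3 ∷ 5 ∷ 0 ∷ 5 ∷ 4 ∷ 0 ∷ 8 ∷ 1 ∷ 2 ∷ 1 ∷ 1 ∷ 0 ∷ 1 ∷ 8 ∷ 1 ∷ 7 ∷ 3 ∷ 4 ∷ 3 ∷ 0 ∷ 8 ∷ 5 ∷ 0 ∷ 0 ∷ 4 ∷ 2 ∷ 7 ∷ 1 ∷ 2 ∷ 6 ∷ 0 ∷ 7 ∷
      7 ∷ 5 ∷ 0 ∷ 3 ∷ 3 ∷ 0 ∷ 0 ∷ 0 ∷ 2 ∷ 5 ∷ 0 ∷ 4 ∷ 1 ∷ 2 ∷ 7 ∷ 1 ∷ 2 ∷ 6 ∷ 3 ∷ 2 ∷ 0 ∷ 5 ∷ 0 ∷ 1 ∷ 3 ∷ 6 ∷ 0 ∷ 1 ∷ 2 ∷ 1 ∷ 0 ∷ 0 ∷ 1 ∷ 0 ∷ 7 ∷ 1 ∷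
      5 ∷ 6 ∷ 3 ∷ 3 ∷ 0 ∷ 2 ∷ 4 ∷ 0 ∷ 3 ∷ 1 ∷ 0 ∷ 0 ∷ 6 ∷ 2 ∷ 4 ∷ 0 ∷ 2 ∷ 2 ∷ 7 ∷ 0 ∷ 1 ∷ 6 ∷ 0 ∷ 5 ∷ 0 ∷ 2 ∷ 1 ∷ 0 ∷ 4 ∷ 1 ∷ 2 ∷ 5 ∷ 0 ∷ 0 ∷ 3 ∷ [])
  ∷ ( 8 ∷ 0 ∷ 1 ∷ 1 ∷ 5 ∷ 0 ∷ 0 ∷ 8 ∷ 1 ∷ 0 ∷ 4 ∷ 4 ∷ 6 ∷ 1 ∷ 8 ∷ 2 ∷ 3 ∷ 1 ∷ 0 ∷ 6 ∷ 5 ∷ 1 ∷ 0 ∷ 3 ∷ 2 ∷ 1 ∷ 1 ∷ 4 ∷ 3 ∷ 0 ∷ 0 ∷ 2 ∷ 3 ∷ 4 ∷ 0 ∷ 2 ∷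
      1 ∷ 0 ∷ 2 ∷ 3 ∷ 0 ∷ 6 ∷ 0 ∷ 4 ∷ 1 ∷ 7 ∷ 4 ∷ 1 ∷ 6 ∷ 3 ∷ 3 ∷ 5 ∷ 0 ∷ 5 ∷ 8 ∷ 1 ∷ 6 ∷ 3 ∷ 2 ∷ 0 ∷ 2 ∷ 7 ∷ 2 ∷ 8 ∷ 4 ∷ 1 ∷ 0 ∷ 7 ∷ 7 ∷ 0 ∷ 0 ∷ 3 ∷
      6 ∷ 0 ∷ 4 ∷ 4 ∷ 3 ∷ 1 ∷ 0 ∷ 4 ∷ 8 ∷ 2 ∷ 0 ∷ 2 ∷ 1 ∷ 2 ∷ 4 ∷ 0 ∷ 1 ∷ 8 ∷ 7 ∷ 1 ∷ 2 ∷ 5 ∷ 1 ∷ 7 ∷ 5 ∷ 0 ∷ 1 ∷ 6 ∷ 0 ∷ 6 ∷ 2 ∷ 6 ∷ 0 ∷ 0 ∷ 4 ∷ 1 ∷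
      4 ∷ 1 ∷ 0 ∷ 0 ∷ 0 ∷ 5 ∷ 5 ∷ 0 ∷ 5 ∷ 0 ∷ 0 ∷ 6 ∷ 0 ∷ 2 ∷ 0 ∷ 0 ∷ 7 ∷ 0 ∷ 6 ∷ 1 ∷ 2 ∷ 3 ∷ 1 ∷ 0 ∷ 6 ∷ 0 ∷ 4 ∷ 0 ∷ 8 ∷ 3 ∷ 0 ∷ 0 ∷ 1 ∷ 1 ∷ 1 ∷ [])
  ∷ ( 6 ∷ 1 ∷ 0 ∷ 0 ∷ 2 ∷ 1 ∷ 7 ∷ 8 ∷ 1 ∷ 1 ∷ 2 ∷ 7 ∷ 2 ∷ 0 ∷ 0 ∷ 0 ∷ 0 ∷ 4 ∷ 0 ∷ 1 ∷ 7 ∷ 6 ∷ 4 ∷ 2 ∷ 1 ∷ 0 ∷ 0 ∷ 1 ∷ 1 ∷ 6 ∷ 0 ∷ 3 ∷ 5 ∷ 2 ∷ 3 ∷ 0 ∷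
      1 ∷ 0 ∷ 1 ∷ 0 ∷ 8 ∷ 1 ∷ 4 ∷ 1 ∷ 3 ∷ 6 ∷ 1 ∷ 8 ∷ 0 ∷ 3 ∷ 1 ∷ 5 ∷ 0 ∷ 0 ∷ 0 ∷ 1 ∷ 0 ∷ 2 ∷ 2 ∷ 0 ∷ 1 ∷ 0 ∷ 1 ∷ 7 ∷ 7 ∷ 1 ∷ 6 ∷ 4 ∷ 3 ∷ 3 ∷ 5 ∷ 2 ∷
      3 ∷ 1 ∷ 6 ∷ 5 ∷ 1 ∷ 0 ∷ 2 ∷ 1 ∷ 0 ∷ 1 ∷ 3 ∷ 2 ∷ 1 ∷ 7 ∷ 4 ∷ 3 ∷ 1 ∷ 0 ∷ 2 ∷ 0 ∷ 0 ∷ 1 ∷ 0 ∷ 4 ∷ 2 ∷ 2 ∷ 6 ∷ 0 ∷ 6 ∷ 1 ∷ 2 ∷ 1 ∷ 0 ∷ 4 ∷ 0 ∷ 2 ∷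
      0 ∷ 5 ∷ 0 ∷ 1 ∷ 6 ∷ 4 ∷ 4 ∷ 4 ∷ 7 ∷ 1 ∷ 0 ∷ 6 ∷ 2 ∷ 2 ∷ 0 ∷ 2 ∷ 1 ∷ 2 ∷ 0 ∷ 0 ∷ 2 ∷ 0 ∷ 2 ∷ 1 ∷ 4 ∷ 4 ∷ 7 ∷ 7 ∷ 5 ∷ 0 ∷ 6 ∷ 3 ∷ 3 ∷ 1 ∷ 0 ∷ [])
  ∷ ( 0 ∷ 5 ∷ 0 ∷ 1 ∷ 0 ∷ 6 ∷ 4 ∷ 0 ∷ 1 ∷ 1 ∷ 7 ∷ 0 ∷ 0 ∷ 2 ∷ 4 ∷ 7 ∷ 6 ∷ 3 ∷ 5 ∷ 6 ∷ 1 ∷ 0 ∷ 8 ∷ 0 ∷ 0 ∷ 0 ∷ 5 ∷ 0 ∷ 1 ∷ 0 ∷ 4 ∷ 8 ∷ 1 ∷ 4 ∷ 0 ∷ 2 ∷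
      0 ∷ 0 ∷ 5 ∷ 5 ∷ 0 ∷ 0 ∷ 0 ∷ 2 ∷ 1 ∷ 7 ∷ 2 ∷ 2 ∷ 1 ∷ 7 ∷ 7 ∷ 5 ∷ 1 ∷ 3 ∷ 3 ∷ 3 ∷ 0 ∷ 4 ∷ 2 ∷ 1 ∷ 8 ∷ 1 ∷ 1 ∷ 1 ∷ 2 ∷ 1 ∷ 1 ∷ 1 ∷ 8 ∷ 2 ∷ 1 ∷ 1 ∷
      4 ∷ 2 ∷ 0 ∷ 0 ∷ 8 ∷ 6 ∷ 0 ∷ 1 ∷ 2 ∷ 0 ∷ 8 ∷ 2 ∷ 7 ∷ 0 ∷ 4 ∷ 6 ∷ 2 ∷ 1 ∷ 0 ∷ 3 ∷ 4 ∷ 8 ∷ 8 ∷ 6 ∷ 0 ∷ 0 ∷ 5 ∷ 1 ∷ 4 ∷ 4 ∷ 7 ∷ 4 ∷ 0 ∷ 6 ∷ 1 ∷ 2 ∷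
      0 ∷ 0 ∷ 0 ∷ 5 ∷ 0 ∷ 0 ∷ 0 ∷ 1 ∷ 7 ∷ 2 ∷ 2 ∷ 0 ∷ 7 ∷ 7 ∷ 7 ∷ 0 ∷ 6 ∷ 3 ∷ 3 ∷ 0 ∷ 2 ∷ 6 ∷ 3 ∷ 0 ∷ 4 ∷ 1 ∷ 1 ∷ 0 ∷ 2 ∷ 1 ∷ 1 ∷ 0 ∷ 8 ∷ 7 ∷ 0 ∷ [])
  ∷ ( 2 ∷ 2 ∷ 4 ∷ 0 ∷ 0 ∷ 0 ∷ 1 ∷ 4 ∷ 2 ∷ 5 ∷ 6 ∷ 7 ∷ 7 ∷ 0 ∷ 1 ∷ 5 ∷ 3 ∷ 5 ∷ 0 ∷ 4 ∷ 5 ∷ 1 ∷ 8 ∷ 6 ∷ 1 ∷ 0 ∷ 2 ∷ 0 ∷ 0 ∷ 8 ∷ 1 ∷ 0 ∷ 2 ∷ 4 ∷ 2 ∷ 2 ∷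
      1 ∷ 0 ∷ 1 ∷ 2 ∷ 0 ∷ 5 ∷ 2 ∷ 1 ∷ 2 ∷ 2 ∷ 1 ∷ 0 ∷ 2 ∷ 0 ∷ 0 ∷ 7 ∷ 1 ∷ 1 ∷ 8 ∷ 0 ∷ 1 ∷ 2 ∷ 0 ∷ 4 ∷ 2 ∷ 2 ∷ 1 ∷ 4 ∷ 4 ∷ 4 ∷ 1 ∷ 2 ∷ 1 ∷ 0 ∷ 8 ∷ 0 ∷
      1 ∷ 5 ∷ 0 ∷ 5 ∷ 6 ∷ 0 ∷ 0 ∷ 3 ∷ 2 ∷ 0 ∷ 0 ∷ 7 ∷ 2 ∷ 5 ∷ 2 ∷ 3 ∷ 3 ∷ 6 ∷ 1 ∷ 3 ∷ 0 ∷ 2 ∷ 0 ∷ 8 ∷ 0 ∷ 4 ∷ 1 ∷ 1 ∷ 1 ∷ 1 ∷ 8 ∷ 1 ∷ 2 ∷ 5 ∷ 1 ∷ 5 ∷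
      1 ∷ 8 ∷ 0 ∷ 4 ∷ 2 ∷ 0 ∷ 4 ∷ 7 ∷ 4 ∷ 1 ∷ 2 ∷ 1 ∷ 2 ∷ 6 ∷ 3 ∷ 5 ∷ 0 ∷ 2 ∷ 2 ∷ 3 ∷ 3 ∷ 0 ∷ 3 ∷ 5 ∷ 0 ∷ 5 ∷ 0 ∷ 0 ∷ 4 ∷ 5 ∷ 1 ∷ 0 ∷ 0 ∷ 3 ∷ 0 ∷ [])
  ∷ ( 7 ∷ 5 ∷ 7 ∷ 4 ∷ 5 ∷ 1 ∷ 2 ∷ 2 ∷ 0 ∷ 0 ∷ 1 ∷ 1 ∷ 6 ∷ 4 ∷ 1 ∷ 3 ∷ 5 ∷ 3 ∷ 4 ∷ 2 ∷ 1 ∷ 8 ∷ 0 ∷ 2 ∷ 2 ∷ 0 ∷ 0 ∷ 0 ∷ 2 ∷ 5 ∷ 1 ∷ 0 ∷ 3 ∷ 1 ∷ 1 ∷ 2 ∷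
      4 ∷ 0 ∷ 1 ∷ 0 ∷ 1 ∷ 7 ∷ 0 ∷ 1 ∷ 0 ∷ 4 ∷ 3 ∷ 0 ∷ 0 ∷ 4 ∷ 1 ∷ 1 ∷ 2 ∷ 8 ∷ 8 ∷ 4 ∷ 2 ∷ 8 ∷ 4 ∷ 0 ∷ 0 ∷ 1 ∷ 1 ∷ 0 ∷ 4 ∷ 3 ∷ 6 ∷ 1 ∷ 2 ∷ 6 ∷ 2 ∷ 2 ∷
      5 ∷ 5 ∷ 5 ∷ 2 ∷ 3 ∷ 0 ∷ 3 ∷ 2 ∷ 2 ∷ 1 ∷ 7 ∷ 4 ∷ 7 ∷ 2 ∷ 3 ∷ 0 ∷ 0 ∷ 1 ∷ 3 ∷ 0 ∷ 4 ∷ 6 ∷ 3 ∷ 0 ∷ 3 ∷ 6 ∷ 0 ∷ 7 ∷ 8 ∷ 8 ∷ 1 ∷ 3 ∷ 3 ∷ 6 ∷ 7 ∷ 1 ∷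
      0 ∷ 6 ∷ 4 ∷ 6 ∷ 0 ∷ 7 ∷ 2 ∷ 4 ∷ 1 ∷ 3 ∷ 3 ∷ 5 ∷ 6 ∷ 6 ∷ 3 ∷ 0 ∷ 2 ∷ 2 ∷ 6 ∷ 0 ∷ 8 ∷ 0 ∷ 1 ∷ 7 ∷ 5 ∷ 8 ∷ 8 ∷ 0 ∷ 0 ∷ 1 ∷ 0 ∷ 0 ∷ 3 ∷ 0 ∷ 3 ∷ [])
  ∷ []

bfsIndex : G → Fin 9
bfsIndex (x , y) = Vec.lookup (Vec.lookup bfsTree x) y mod 9

towardsE : G → G
towardsE g = g · List.lookup connectionSet (bfsIndex g)

towardsE-adj : ∀ g → Adj (towardsE g) g
towardsE-adj g = adj-back g (Equivalence.to ∈⇔InS (∈-lookup {xs = connectionSet} (bfsIndex g)))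

module _ (next : G → G) where

  reachesEWithin : ℕ → G → Bool
  reachesEWithin zero    g = does (g ≟ e)
  reachesEWithin (suc k) g = does (g ≟ e) ∨ reachesEWithin k (next g)

  reachesEWithin⇒DistLe : (∀ g → Adj (next g) g) → ∀ k g → T (reachesEWithin k g) → DistLe e g k
  reachesEWithin⇒DistLe next-adj zero g ok with g ≟ e
  ... | yes refl = 0 , z≤n , here
  reachesEWithin⇒DistLe next-adj (suc k) g ok with g ≟ e
  ... | yes refl = 0 , z≤n , here
  ... | no _ with reachesEWithin⇒DistLe next-adj k (next g) ok
  ...   | n , n≤k , w = suc n , s≤s n≤k , w ∷ʳ next-adj g

reachesEWithin-4 : ∀ g → T (reachesEWithin towardsE 4 g)
reachesEWithin-4 = all-vertices-sound (reachesEWithin towardsE 4) tt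

DistLe-e-4 : ∀ g → DistLe e g 4
DistLe-e-4 g = reachesEWithin⇒DistLe towardsE towardsE-adj 4 g (reachesEWithin-4 g)

DistLe-4 : ∀ x y → DistLe x y 4
DistLe-4 x y =
  subst₂ (λ u v → DistLe u v 4) (identityʳ x) (\\-leftDividesˡ x y) (DistLe-translate x (DistLe-e-4 ((x ⁻¹) · y)))

walk? : ∀ n x y → Dec (Walk x y n)
walk? zero    x y = map′ (λ { refl → here }) (λ { here → refl }) (x ≟ y)
walk? (suc n) x y = map′ from to (any? (λ s → walk? n (x · s) y) connectionSet)
  where
  from : Any (λ s → Walk (x · s) y n) connectionSet → Walk x y (suc n)
  from p with find p
  ... | s , s∈ , w = step (s , Equivalence.to ∈⇔InS s∈ , refl) w
  to : Walk x y (suc n) → Any (λ s → Walk (x · s) y n) connectionSet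
  to (step (s , s∈S , refl) w) = lose (Equivalence.from ∈⇔InS s∈S) w

noWalk<4 : ∀ n → n < 4 → ¬ Walk e [ 0 , 1 ] n
noWalk<4 0 _ = from-no (walk? 0 e [ 0 , 1 ])
noWalk<4 1 _ = from-no (walk? 1 e [ 0 , 1 ])
noWalk<4 2 _ = from-no (walk? 2 e [ 0 , 1 ])
noWalk<4 3 _ = from-no (walk? 3 e [ 0 , 1 ])
noWalk<4 (suc (suc (suc (suc _)))) (s≤s (s≤s (s≤s (s≤s ()))))

mainTheorem9 : HasCard InS 9 × (∀ s → InS s → ¬ s ≡ e) × Connected × Regular 9 × Diameter 4 × NumVertices 1430
mainTheorem9 =
  cardS ,
  InS⇒≢e ,
  (λ x y → DistLe⇒Walk (DistLe-4 x y)) ,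
  regular ,
  (DistLe-4 , e , [ 0 , 1 ] , noWalk<4) ,
  numVertices
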